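{- Let $x,y$ be two vertices of $Q_d$ and let $M$ be a perfect matching of $K(Q_d\setminus\{x,y\})$. Let $C$ be a cycle that extends $M$ and avoids $x$. Then $C$ avoids $y$ if and only if $x$ and $y$ have opposite parity.
   Context: $Q_d$ is the graph with vertex set all subsets of $[d]=\{1,\ldots,d\}$, two sets adjacent iff they differ in exactly one element. $K(Q_d\setminus\{x,y\})$ is the complete graph on $V(Q_d)\setminus\{x,y\}$. A cycle $C$ (in the complete graph on $V(Q_d)$) extends $M$ if $M\subseteq E(C)$ and every edge of $E(C)\setminus M$ is an edge of $Q_d$; $C$ avoids a vertex if the vertex is not on $C$. The parity of a vertex $u$ is the parity of $|u|$. -}

module Defs where

open import Data.Nat using (ℕ; _≤_; _%_)
open import Data.Bool using (Bool)
open import Data.Fin using (Fin)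
open import Data.Fin.Subset using (Subset; ∣_∣)
open import Data.Vec using (lookup)
open import Data.List using (List; []; _∷_; _++_; length)
open import Data.List.Relation.Unary.Unique.Propositional using (Unique)
open import Data.List.Membership.Propositional using (_∉_)
open import Data.Product using (Σ; _×_)
open import Data.Sum using (_⊎_)
open import Relation.Nullary using (¬_)
open import Relation.Binary.PropositionalEquality using (_≡_; _≢_)

-- Vertices of Q_d: subsets of [d], represented as characteristic vectors.
V : ℕ → Set
V d = Subset d

QAdj : ∀ {d} → V d → V d → Set
QAdj {d} u v = Σ (Fin d) λ i →
  (lookup u i ≢ lookup v i) × (∀ j → j ≢ i → lookup u j ≡ lookup v j)

OppositeParity : ∀ {d} → V d → V d → Set
OppositeParity x y = ∣ x ∣ % 2 ≢ ∣ y ∣ % 2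

EdgeRel : ℕ → Set₁
EdgeRel d = V d → V d → Set

IsPerfectMatchingAvoiding : ∀ {d} → V d → V d → EdgeRel d → Set
IsPerfectMatchingAvoiding x y M =
  (∀ u v → M u v → M v u) ×
  (∀ u v → M u v → u ≢ v) ×
  (∀ u v → M u v → (u ≢ x) × (u ≢ y)) ×
  (∀ u → u ≢ x → u ≢ y →
     Σ _ λ v → M u v × (∀ w → M u w → w ≡ v))

data Step {A : Set} : List A → A → A → Set where
  here  : ∀ {a b r} → Step (a ∷ b ∷ r) a b
  there : ∀ {a r u v} → Step r u v → Step (a ∷ r) u v

-- A cycle in the complete graph on V d: a list v₀ … v_{k-1} of k ≥ 3
-- distinct vertices; its edges are {v_i, v_{i+1 mod k}}.
record Cycle (d : ℕ) : Set where
  constructor cycle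
  field
    verts  : List (V d)
    long   : 3 ≤ length verts
    unique : Unique verts

open Cycle public

CStep : ∀ {d} → List (V d) → V d → V d → Set
CStep []       u v = Step [] u v
CStep (a ∷ r)  u v = Step ((a ∷ r) ++ (a ∷ [])) u v

CycleEdge : ∀ {d} → Cycle d → V d → V d → Set
CycleEdge C u v = CStep (verts C) u v ⊎ CStep (verts C) v u

Extends : ∀ {d} → Cycle d → EdgeRel d → Set
Extends C M =
  (∀ u v → M u v → CycleEdge C u v) ×
  (∀ u v → CycleEdge C u v → ¬ M u v → QAdj u v)

Avoids : ∀ {d} → Cycle d → V d → Set
Avoids C z = z ∉ verts C

-- Weight every vertex v of Q_d by σ v = (-1)^|v|. For d ≥ 1 these weights sum to 0, and the
-- two ends of an edge of Q_d have opposite weights. Going around C, the non-matching edges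
-- therefore contribute nothing to Σ_{edges uw} (σ u + σ w) = 2 Σ_{v ∈ C} σ v, while the matching
-- edges contribute σ v once for every vertex v ≠ y of C: y is unmatched, and every other vertex of
-- C has exactly one of its two cycle edges in M. Hence Σ_{v ∈ C} σ v is -σ y if C passes through y
-- and 0 otherwise. As C covers every vertex except x and possibly y, comparing with the total sum
-- gives σ x = σ y in the first case and σ x = -σ y in the second.

module Submission where

open import Defs
open import Data.Nat using (ℕ; zero; suc; _%_; s≤s)
open import Data.Bool using (true; false)
import Data.Bool.Properties as Bool
open import Data.Empty using (⊥; ⊥-elim)
open import Data.Fin using (zero; suc)
import Data.Fin.Properties as Fin
open import Data.Fin.Subset using (Subset; ∣_∣; inside; outside)
open import Data.Integer using (ℤ; 0ℤ; 1ℤ; _+_; _*_; -_)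
import Data.Integer.Properties as ℤ
open import Data.Integer.Tactic.RingSolver using (solve-∀)
open import Data.List using (List; []; _∷_; _++_; _∷ʳ_; foldr; map)
open import Data.List.Properties using (map-∘; map-++; map-cong; map-cong-local)
open import Data.List.Membership.Propositional using (_∈_; _∉_)
open import Data.List.Membership.Propositional.Properties using (∈-map⁺; ∈-map⁻; ∈-++⁺ˡ; ∈-++⁺ʳ; ∈-++⁻)
open import Data.List.Membership.Propositional.Properties.WithK using (unique∧set⇒bag)
open import Data.List.Relation.Binary.BagAndSetEquality using (∼bag⇒↭)
open import Data.List.Relation.Binary.Permutation.Propositional using (_↭_; ↭-refl; ↭-sym; ↭⇒↭ₛ)
open import Data.List.Relation.Binary.Permutation.Propositional.Properties using (map⁺; ∈-resp-↭; ∷↭∷ʳ)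
open import Data.List.Relation.Binary.Permutation.Setoid.Properties using (foldr-commMonoid; Unique-resp-↭)
open import Data.List.Relation.Unary.All as All using ([]; _∷_)
open import Data.List.Relation.Unary.All.Properties using (¬Any⇒All¬)
open import Data.List.Relation.Unary.Any using (here; there)
open import Data.List.Relation.Unary.AllPairs using ([]; _∷_)
open import Data.List.Relation.Unary.Unique.Propositional using (Unique)
import Data.List.Relation.Unary.Unique.Propositional.Properties as Unique
open import Data.Product using (Σ; _×_; _,_; proj₁; proj₂)
open import Data.Sum using (_⊎_; inj₁; inj₂)
open import Data.Vec using ([]; _∷_)
import Data.Vec.Properties as Vec
open import Data.Vec.Relation.Binary.Pointwise.Extensional using (ext; Pointwise-≡⇒≡)
open import Function using (_∘_)
open import Function.Bundles using (_⇔_; mk⇔)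
open import Relation.Binary.Core using (_Preserves_⟶_)
open import Relation.Binary.Definitions using (DecidableEquality)
open import Relation.Binary.PropositionalEquality
open import Relation.Nullary using (¬_; Dec; yes; no)

sum : List ℤ → ℤ
sum = foldr _+_ 0ℤ

sum-↭ : sum Preserves _↭_ ⟶ _≡_
sum-↭ p = foldr-commMonoid (setoid ℤ) ℤ.+-0-isCommutativeMonoid (↭⇒↭ₛ p)

+-inverse-unique : ∀ {a s b} → a + s ≡ 0ℤ → s + b ≡ 0ℤ → a ≡ b
+-inverse-unique {a} {s} {b} a+s≡0 s+b≡0 =
  trans (regroup a s b) (trans (cong₂ (λ p q → p + - q + b) a+s≡0 s+b≡0) (ℤ.+-identityˡ b))
  where
  regroup : ∀ a s b → a ≡ (a + s) + - (s + b) + b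
  regroup = solve-∀

sum-++ : ∀ xs ys → sum (xs ++ ys) ≡ sum xs + sum ys
sum-++ []       ys = sym (ℤ.+-identityˡ (sum ys))
sum-++ (x ∷ xs) ys = trans (cong (x +_) (sum-++ xs ys)) (sym (ℤ.+-assoc x (sum xs) (sum ys)))

module _ {A : Set} where

  sum-map-+ : ∀ (g h : A → ℤ) xs →
              sum (map (λ a → g a + h a) xs) ≡ sum (map g xs) + sum (map h xs)
  sum-map-+ g h [] = refl
  sum-map-+ g h (x ∷ xs) =
    trans (cong (g x + h x +_) (sum-map-+ g h xs))
          (interchange (g x) (h x) (sum (map g xs)) (sum (map h xs)))
    where
    interchange : ∀ a b c d → (a + b) + (c + d) ≡ (a + c) + (b + d)
    interchange = solve-∀

  sum-map-neg : ∀ (g : A → ℤ) xs → sum (map (λ a → - g a) xs) ≡ - sum (map g xs)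
  sum-map-neg g [] = refl
  sum-map-neg g (x ∷ xs) =
    trans (cong (- g x +_) (sum-map-neg g xs)) (sym (ℤ.neg-distrib-+ (g x) _))

  sum-map-cong : ∀ {g h : A → ℤ} xs → (∀ {a} → a ∈ xs → g a ≡ h a) →
                 sum (map g xs) ≡ sum (map h xs)
  sum-map-cong xs g≗h = cong sum (map-cong-local (All.tabulate g≗h))

  sum-map-↭ : ∀ (g : A → ℤ) {xs ys} → xs ↭ ys → sum (map g xs) ≡ sum (map g ys)
  sum-map-↭ g p = sum-↭ (map⁺ g p)

  unique-sameElements⇒↭ : ∀ {xs ys : List A} → Unique xs → Unique ys →
                          (∀ {a} → a ∈ xs ⇔ a ∈ ys) → xs ↭ ys
  unique-sameElements⇒↭ uxs uys same = ∼bag⇒↭ (unique∧set⇒bag uxs uys same)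

  Unique-map⇒≡ : ∀ {B : Set} {k : A → B} {xs p q} → Unique (map k xs) →
                 p ∈ xs → q ∈ xs → k p ≡ k q → p ≡ q
  Unique-map⇒≡ _ (here refl) (here refl) _ = refl
  Unique-map⇒≡ {k = k} (kx∉ ∷ _) (here refl) (there q∈) kp≡kq =
    ⊥-elim (All.lookup kx∉ (∈-map⁺ k q∈) kp≡kq)
  Unique-map⇒≡ {k = k} (kx∉ ∷ _) (there p∈) (here refl) kp≡kq =
    ⊥-elim (All.lookup kx∉ (∈-map⁺ k p∈) (sym kp≡kq))
  Unique-map⇒≡ (_ ∷ u) (there p∈) (there q∈) kp≡kq = Unique-map⇒≡ u p∈ q∈ kp≡kq

𝟙 : {P : Set} → Dec P → ℤ
𝟙 (yes _) = 1ℤ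
𝟙 (no _)  = 0ℤ

𝟙-yes : ∀ {P : Set} (P? : Dec P) → P → 𝟙 P? ≡ 1ℤ
𝟙-yes (yes _) _ = refl
𝟙-yes (no ¬p) p = ⊥-elim (¬p p)

𝟙-no : ∀ {P : Set} (P? : Dec P) → ¬ P → 𝟙 P? ≡ 0ℤ
𝟙-no (yes p) ¬p = ⊥-elim (¬p p)
𝟙-no (no _)  _  = refl

module _ {A : Set} (_≟_ : DecidableEquality A) (g : A → ℤ) {y : A} where

  sum-map-𝟙-∉ : ∀ {xs} → y ∉ xs → sum (map (λ v → 𝟙 (v ≟ y) * g v) xs) ≡ 0ℤ
  sum-map-𝟙-∉ {[]} _ = refl
  sum-map-𝟙-∉ {v ∷ xs} y∉ =
    trans (cong₂ _+_ (cong (_* g v) (𝟙-no (v ≟ y) (λ v≡y → y∉ (here (sym v≡y)))))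
                     (sum-map-𝟙-∉ (y∉ ∘ there)))
          (ℤ.+-identityʳ 0ℤ)

  sum-map-𝟙-∈ : ∀ {xs} → Unique xs → y ∈ xs → sum (map (λ v → 𝟙 (v ≟ y) * g v) xs) ≡ g y
  sum-map-𝟙-∈ {v ∷ xs} (v∉ ∷ _) (here refl) =
    trans (cong₂ _+_ (cong (_* g v) (𝟙-yes (v ≟ v) refl))
                     (sum-map-𝟙-∉ (λ v∈ → All.lookup v∉ v∈ refl)))
          (trans (ℤ.+-identityʳ _) (ℤ.*-identityˡ (g v)))
  sum-map-𝟙-∈ {v ∷ xs} (v∉ ∷ u) (there y∈) =
    trans (cong₂ _+_ (cong (_* g v) (𝟙-no (v ≟ y) (λ { refl → All.lookup v∉ y∈ refl })))
                     (sum-map-𝟙-∈ u y∈))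
          (ℤ.+-identityˡ (g y))

module _ {A : Set} where

  pairs : List A → List (A × A)
  pairs []          = []
  pairs (a ∷ [])    = []
  pairs (a ∷ b ∷ t) = (a , b) ∷ pairs (b ∷ t)

  triples : List A → List (A × A × A)
  triples []              = []
  triples (a ∷ [])        = []
  triples (a ∷ b ∷ [])    = []
  triples (a ∷ b ∷ c ∷ t) = (a , b , c) ∷ triples (b ∷ c ∷ t)

  lastOf : A → List A → A
  lastOf a []      = a
  lastOf a (b ∷ t) = lastOf b t

  lastOf-∈ : ∀ a t → lastOf a t ∈ a ∷ t
  lastOf-∈ a []      = here refl
  lastOf-∈ a (b ∷ t) = there (lastOf-∈ b t)

  Step⇒∈-pairs : ∀ {xs u w} → Step xs u w → (u , w) ∈ pairs xs
  Step⇒∈-pairs here                  = here refl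
  Step⇒∈-pairs {_ ∷ _ ∷ _} (there s) = there (Step⇒∈-pairs s)

  ∈-pairs⇒Step : ∀ xs {u w} → (u , w) ∈ pairs xs → Step xs u w
  ∈-pairs⇒Step (a ∷ b ∷ t) (here refl) = here
  ∈-pairs⇒Step (a ∷ b ∷ t) (there p∈) = there (∈-pairs⇒Step (b ∷ t) p∈)

  map-proj₁-pairs-∷ʳ : ∀ xs e → map proj₁ (pairs (xs ∷ʳ e)) ≡ xs
  map-proj₁-pairs-∷ʳ []          e = refl
  map-proj₁-pairs-∷ʳ (a ∷ [])    e = refl
  map-proj₁-pairs-∷ʳ (a ∷ b ∷ t) e = cong (a ∷_) (map-proj₁-pairs-∷ʳ (b ∷ t) e)

  map-proj₂-pairs-∷ : ∀ a xs → map proj₂ (pairs (a ∷ xs)) ≡ xs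
  map-proj₂-pairs-∷ a []      = refl
  map-proj₂-pairs-∷ a (b ∷ t) = cong (b ∷_) (map-proj₂-pairs-∷ b t)

  pairs-∷ʳ : ∀ a t e → pairs (a ∷ t ∷ʳ e) ≡ pairs (a ∷ t) ∷ʳ (lastOf a t , e)
  pairs-∷ʳ a []      e = refl
  pairs-∷ʳ a (b ∷ t) e = cong ((a , b) ∷_) (pairs-∷ʳ b t e)

  front : A × A × A → A × A
  front (p , v , _) = p , v

  back : A × A × A → A × A
  back (_ , v , n) = v , n

  map-back-triples-∷ : ∀ a xs → map back (triples (a ∷ xs)) ≡ pairs xs
  map-back-triples-∷ a []          = refl
  map-back-triples-∷ a (b ∷ [])    = refl
  map-back-triples-∷ a (b ∷ c ∷ t) = cong ((b , c) ∷_) (map-back-triples-∷ b (c ∷ t))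

  map-front-triples-∷ʳ : ∀ xs e → map front (triples (xs ∷ʳ e)) ≡ pairs xs
  map-front-triples-∷ʳ []               e = refl
  map-front-triples-∷ʳ (a ∷ [])         e = refl
  map-front-triples-∷ʳ (a ∷ b ∷ [])     e = refl
  map-front-triples-∷ʳ (a ∷ b ∷ c ∷ t)  e =
    cong ((a , b) ∷_) (map-front-triples-∷ʳ (b ∷ c ∷ t) e)

  -- For xs = v₀ … v_{k-1}: the steps (vᵢ , vᵢ₊₁) and the triples (vᵢ₋₁ , vᵢ , vᵢ₊₁), indices mod k.
  cyclicPairs : List A → List (A × A)
  cyclicPairs []      = []
  cyclicPairs (a ∷ t) = pairs (a ∷ t ∷ʳ a)

  cyclicTriples : List A → List (A × A × A)
  cyclicTriples []      = []
  cyclicTriples (a ∷ t) = triples (lastOf a t ∷ a ∷ t ∷ʳ a)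

  map-proj₁-cyclicPairs : ∀ xs → map proj₁ (cyclicPairs xs) ≡ xs
  map-proj₁-cyclicPairs []      = refl
  map-proj₁-cyclicPairs (a ∷ t) = map-proj₁-pairs-∷ʳ (a ∷ t) a

  map-proj₂-cyclicPairs : ∀ xs → map proj₂ (cyclicPairs xs) ↭ xs
  map-proj₂-cyclicPairs []      = ↭-refl
  map-proj₂-cyclicPairs (a ∷ t) =
    subst (_↭ a ∷ t) (sym (map-proj₂-pairs-∷ a (t ∷ʳ a))) (↭-sym (∷↭∷ʳ a t))

  map-back-cyclicTriples : ∀ xs → map back (cyclicTriples xs) ≡ cyclicPairs xs
  map-back-cyclicTriples []      = refl
  map-back-cyclicTriples (a ∷ t) = map-back-triples-∷ (lastOf a t) (a ∷ t ∷ʳ a)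

  map-front-cyclicTriples : ∀ xs → map front (cyclicTriples xs) ↭ cyclicPairs xs
  map-front-cyclicTriples []      = ↭-refl
  map-front-cyclicTriples (a ∷ t) =
    subst₂ _↭_ (sym (map-front-triples-∷ʳ (lastOf a t ∷ a ∷ t) a)) (sym (pairs-∷ʳ a t a))
           (∷↭∷ʳ (lastOf a t , a) (pairs (a ∷ t)))

  sum-cyclicPairs-endpoints : ∀ (g : A → ℤ) xs →
    sum (map (λ (u , w) → g u + g w) (cyclicPairs xs)) ≡ sum (map g xs) + sum (map g xs)
  sum-cyclicPairs-endpoints g xs = begin
    sum (map (λ (u , w) → g u + g w) P)
      ≡⟨ sum-map-+ (g ∘ proj₁) (g ∘ proj₂) P ⟩
    sum (map (g ∘ proj₁) P) + sum (map (g ∘ proj₂) P)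
      ≡⟨ cong₂ _+_ (cong sum (map-∘ P)) (cong sum (map-∘ P)) ⟩
    sum (map g (map proj₁ P)) + sum (map g (map proj₂ P))
      ≡⟨ cong₂ _+_ (cong (sum ∘ map g) (map-proj₁-cyclicPairs xs))
                   (sum-map-↭ g (map-proj₂-cyclicPairs xs)) ⟩
    sum (map g xs) + sum (map g xs)
      ∎
    where
    open ≡-Reasoning
    P : List (A × A)
    P = cyclicPairs xs

  sum-cyclicTriples-middle : ∀ (g : A → ℤ) xs →
    sum (map (λ (_ , v , _) → g v) (cyclicTriples xs)) ≡ sum (map g xs)
  sum-cyclicTriples-middle g xs = cong sum (begin
    map (g ∘ proj₁ ∘ back) T           ≡⟨ map-∘ T ⟩
    map g (map (proj₁ ∘ back) T)       ≡⟨ cong (map g) (map-∘ T) ⟩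
    map g (map proj₁ (map back T))     ≡⟨ cong (map g ∘ map proj₁) (map-back-cyclicTriples xs) ⟩
    map g (map proj₁ (cyclicPairs xs)) ≡⟨ cong (map g) (map-proj₁-cyclicPairs xs) ⟩
    map g xs                           ∎)
    where
    open ≡-Reasoning
    T : List (A × A × A)
    T = cyclicTriples xs

  -- Double counting: charging h u w to both ends of every step collects, at each vertex v,
  -- the weights of its incoming and its outgoing step.
  sum-cyclicPairs-by-triples : ∀ (h : A → A → ℤ) (g : A → ℤ) xs →
      sum (map (λ (u , w) → h u w * (g u + g w)) (cyclicPairs xs))
    ≡ sum (map (λ (p , v , n) → (h p v + h v n) * g v) (cyclicTriples xs))
  sum-cyclicPairs-by-triples h g xs = begin
    sum (map (λ (u , w) → h u w * (g u + g w)) P)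
      ≡⟨ cong sum (map-cong (λ (u , w) → ℤ.*-distribˡ-+ (h u w) (g u) (g w)) P) ⟩
    sum (map (λ e → out e + inc e) P)
      ≡⟨ sum-map-+ out inc P ⟩
    sum (map out P) + sum (map inc P)
      ≡⟨ cong₂ _+_ (cong (sum ∘ map out) (sym (map-back-cyclicTriples xs)))
                   (sum-map-↭ inc (↭-sym (map-front-cyclicTriples xs))) ⟩
    sum (map out (map back T)) + sum (map inc (map front T))
      ≡⟨ cong₂ _+_ (cong sum (sym (map-∘ T))) (cong sum (sym (map-∘ T))) ⟩
    sum (map (out ∘ back) T) + sum (map (inc ∘ front) T)
      ≡⟨ ℤ.+-comm (sum (map (out ∘ back) T)) _ ⟩
    sum (map (inc ∘ front) T) + sum (map (out ∘ back) T)
      ≡⟨ sum-map-+ (inc ∘ front) (out ∘ back) T ⟨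
    sum (map (λ t → inc (front t) + out (back t)) T)
      ≡⟨ cong sum (map-cong (λ (p , v , n) → ℤ.*-distribʳ-+ (g v) (h p v) (h v n)) T) ⟨
    sum (map (λ (p , v , n) → (h p v + h v n) * g v) T)
      ∎
    where
    open ≡-Reasoning
    P : List (A × A)
    P = cyclicPairs xs
    T : List (A × A × A)
    T = cyclicTriples xs
    out inc : A × A → ℤ
    out (u , w) = h u w * g u
    inc (u , w) = h u w * g w

  cyclicPairs-successor-unique : ∀ {xs u w w′} → Unique xs →
    (u , w) ∈ cyclicPairs xs → (u , w′) ∈ cyclicPairs xs → w ≡ w′
  cyclicPairs-successor-unique {xs} uxs e e′ =
    cong proj₂ (Unique-map⇒≡ (subst Unique (sym (map-proj₁-cyclicPairs xs)) uxs) e e′ refl)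

  cyclicPairs-predecessor-unique : ∀ {xs u u′ w} → Unique xs →
    (u , w) ∈ cyclicPairs xs → (u′ , w) ∈ cyclicPairs xs → u ≡ u′
  cyclicPairs-predecessor-unique {xs} uxs e e′ =
    cong proj₁ (Unique-map⇒≡ unique-successors e e′ refl)
    where
    unique-successors : Unique (map proj₂ (cyclicPairs xs))
    unique-successors = Unique-resp-↭ (setoid A) (↭⇒↭ₛ (↭-sym (map-proj₂-cyclicPairs xs))) uxs

  pairs-asym : ∀ {xs u w} → Unique xs → (u , w) ∈ pairs xs → (w , u) ∈ pairs xs → ⊥
  pairs-asym {a ∷ b ∷ t} (a∉ ∷ _) (here refl) (here ba≡ab) =
    All.lookup a∉ (here refl) (sym (cong proj₁ ba≡ab))
  pairs-asym {a ∷ b ∷ t} (a∉ ∷ _) (here refl) (there ba∈) =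
    All.lookup a∉ (there (subst (a ∈_) (map-proj₂-pairs-∷ b t) (∈-map⁺ proj₂ ba∈))) refl
  pairs-asym {a ∷ b ∷ t} (a∉ ∷ _) (there ba∈) (here refl) =
    All.lookup a∉ (there (subst (a ∈_) (map-proj₂-pairs-∷ b t) (∈-map⁺ proj₂ ba∈))) refl
  pairs-asym {a ∷ b ∷ t} (_ ∷ u) (there uw∈) (there wu∈) = pairs-asym u uw∈ wu∈

  -- This is where a cycle needs at least three vertices.
  cyclicPairs-asym : ∀ {a b c t u w} → Unique (a ∷ b ∷ c ∷ t) →
    (u , w) ∈ cyclicPairs (a ∷ b ∷ c ∷ t) → (w , u) ∈ cyclicPairs (a ∷ b ∷ c ∷ t) → ⊥
  cyclicPairs-asym {a} {b} {c} {t} {u} {w} uxs uw∈ wu∈ =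
    go (split (subst ((u , w) ∈_) closing uw∈)) (split (subst ((w , u) ∈_) closing wu∈))
    where
    xs : List A
    xs = a ∷ b ∷ c ∷ t
    z : A
    z = lastOf c t
    closing : cyclicPairs xs ≡ pairs xs ∷ʳ (z , a)
    closing = pairs-∷ʳ a (b ∷ c ∷ t) a
    split : ∀ {e} → e ∈ pairs xs ∷ʳ (z , a) → e ∈ pairs xs ⊎ e ≡ (z , a)
    split e∈ with ∈-++⁻ (pairs xs) {(z , a) ∷ []} e∈
    ... | inj₁ e∈path     = inj₁ e∈path
    ... | inj₂ (here e≡) = inj₂ e≡
    a∉ : a ∉ b ∷ c ∷ t
    a∉ = Unique.Unique[x∷xs]⇒x∉xs uxs
    b∉ : b ∉ c ∷ t
    b∉ = Unique.Unique[x∷xs]⇒x∉xs (Unique.drop⁺ 1 uxs)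
    last-not-after-first : (a , z) ∈ pairs xs → ⊥
    last-not-after-first az∈ =
      b∉ (subst (_∈ c ∷ t) (cyclicPairs-successor-unique {xs} uxs (lift az∈) (here refl))
                (lastOf-∈ c t))
      where
      lift : ∀ {e} → e ∈ pairs xs → e ∈ cyclicPairs xs
      lift {e} e∈ = subst (e ∈_) (sym closing) (∈-++⁺ˡ e∈)
    go : (u , w) ∈ pairs xs ⊎ (u , w) ≡ (z , a) → (w , u) ∈ pairs xs ⊎ (w , u) ≡ (z , a) → ⊥
    go (inj₁ uw∈) (inj₁ wu∈) = pairs-asym uxs uw∈ wu∈
    go (inj₁ uw∈) (inj₂ refl) = last-not-after-first uw∈
    go (inj₂ refl) (inj₁ wu∈) = last-not-after-first wu∈
    go (inj₂ refl) (inj₂ az≡za) =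
      a∉ (subst (_∈ b ∷ c ∷ t) (sym (cong proj₁ az≡za)) (there (lastOf-∈ c t)))

  ∈-cyclicTriples⇒∈-cyclicPairs : ∀ {xs p v n} → (p , v , n) ∈ cyclicTriples xs →
    (p , v) ∈ cyclicPairs xs × (v , n) ∈ cyclicPairs xs
  ∈-cyclicTriples⇒∈-cyclicPairs {xs} t∈ =
    ∈-resp-↭ (map-front-cyclicTriples xs) (∈-map⁺ front t∈) ,
    subst (_ ∈_) (map-back-cyclicTriples xs) (∈-map⁺ back t∈)

  cyclicTriples-ends-distinct : ∀ {a b c t p v n} → Unique (a ∷ b ∷ c ∷ t) →
    (p , v , n) ∈ cyclicTriples (a ∷ b ∷ c ∷ t) → p ≢ n
  cyclicTriples-ends-distinct {a} {b} {c} {t} uxs t∈ refl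
    with ∈-cyclicTriples⇒∈-cyclicPairs {a ∷ b ∷ c ∷ t} t∈
  ... | pv∈ , vp∈ = cyclicPairs-asym uxs pv∈ vp∈

sgn : ℕ → ℤ
sgn zero    = 1ℤ
sgn (suc n) = - sgn n

σ : ∀ {d} → V d → ℤ
σ v = sgn ∣ v ∣

sgn-%2 : ∀ n → sgn (n % 2) ≡ sgn n
sgn-%2 zero          = refl
sgn-%2 (suc zero)    = refl
sgn-%2 (suc (suc n)) = trans (sgn-%2 n) (sym (ℤ.neg-involutive (sgn n)))

sgn-injective-%2 : ∀ m n → sgn m ≡ sgn n → m % 2 ≡ n % 2
sgn-injective-%2 (suc (suc m)) n e =
  sgn-injective-%2 m n (trans (sym (ℤ.neg-involutive (sgn m))) e)
sgn-injective-%2 m (suc (suc n)) e =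
  sgn-injective-%2 m n (trans e (ℤ.neg-involutive (sgn n)))
sgn-injective-%2 zero       zero       _ = refl
sgn-injective-%2 zero       (suc zero) ()
sgn-injective-%2 (suc zero) zero       ()
sgn-injective-%2 (suc zero) (suc zero) _ = refl

sgn+sgn≢0 : ∀ n → sgn n + sgn n ≢ 0ℤ
sgn+sgn≢0 zero          ()
sgn+sgn≢0 (suc zero)    ()
sgn+sgn≢0 (suc (suc n)) rewrite ℤ.neg-involutive (sgn n) = sgn+sgn≢0 n

σ-adjacent : ∀ {d} {u v : V d} → QAdj u v → σ u + σ v ≡ 0ℤ
σ-adjacent {u = a ∷ u} {b ∷ v} (zero , a≢b , rest)
  with Pointwise-≡⇒≡ {xs = u} {v} (ext λ j → rest (suc j) λ ())
σ-adjacent {u = true  ∷ u} {true  ∷ _} (zero , a≢b , _) | refl = ⊥-elim (a≢b refl)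
σ-adjacent {u = true  ∷ u} {false ∷ _} _                | refl = ℤ.+-inverseˡ (σ u)
σ-adjacent {u = false ∷ u} {true  ∷ _} _                | refl = ℤ.+-inverseʳ (σ u)
σ-adjacent {u = false ∷ u} {false ∷ _} (zero , a≢b , _) | refl = ⊥-elim (a≢b refl)
σ-adjacent {u = a ∷ u} {b ∷ v} (suc k , uk≢vk , rest) with rest zero (λ ())
... | refl =
  σ-∷ a (σ-adjacent {u = u} {v} (k , uk≢vk , λ j j≢k → rest (suc j) (j≢k ∘ Fin.suc-injective)))
  where
  σ-∷ : ∀ a → σ u + σ v ≡ 0ℤ → σ (a ∷ u) + σ (a ∷ v) ≡ 0ℤ
  σ-∷ true  e = trans (sym (ℤ.neg-distrib-+ (σ u) (σ v))) (cong -_ e)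
  σ-∷ false e = e

subsets : ∀ d → List (Subset d)
subsets zero    = [] ∷ []
subsets (suc d) = map (inside ∷_) (subsets d) ++ map (outside ∷_) (subsets d)

∈-subsets : ∀ {d} (v : Subset d) → v ∈ subsets d
∈-subsets []            = here refl
∈-subsets (true  ∷ v)   = ∈-++⁺ˡ (∈-map⁺ (inside ∷_) (∈-subsets v))
∈-subsets {suc d} (false ∷ v) =
  ∈-++⁺ʳ (map (inside ∷_) (subsets d)) (∈-map⁺ (outside ∷_) (∈-subsets v))

subsets-unique : ∀ d → Unique (subsets d)
subsets-unique zero    = [] ∷ []
subsets-unique (suc d) =
  Unique.++⁺ (Unique.map⁺ Vec.∷-injectiveʳ (subsets-unique d))
             (Unique.map⁺ Vec.∷-injectiveʳ (subsets-unique d))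
             different-heads
  where
  different-heads : ∀ {v} →
    ¬ (v ∈ map (inside ∷_) (subsets d) × v ∈ map (outside ∷_) (subsets d))
  different-heads (v∈ , v∈′) with ∈-map⁻ (inside ∷_) v∈ | ∈-map⁻ (outside ∷_) v∈′
  ... | _ , _ , refl | _ , _ , ()

sum-σ-subsets : ∀ d → sum (map σ (subsets (suc d))) ≡ 0ℤ
sum-σ-subsets d = begin
  sum (map σ (map (inside ∷_) S ++ map (outside ∷_) S))
    ≡⟨ cong sum (map-++ σ (map (inside ∷_) S) _) ⟩
  sum (map σ (map (inside ∷_) S) ++ map σ (map (outside ∷_) S))
    ≡⟨ sum-++ (map σ (map (inside ∷_) S)) _ ⟩
  sum (map σ (map (inside ∷_) S)) + sum (map σ (map (outside ∷_) S))
    ≡⟨ cong₂ _+_ (cong sum (sym (map-∘ S))) (cong sum (sym (map-∘ S))) ⟩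
  sum (map (λ v → - σ v) S) + sum (map σ S)
    ≡⟨ cong (_+ sum (map σ S)) (sum-map-neg σ S) ⟩
  - sum (map σ S) + sum (map σ S)
    ≡⟨ ℤ.+-inverseˡ (sum (map σ S)) ⟩
  0ℤ
    ∎
  where
  open ≡-Reasoning
  S : List (Subset d)
  S = subsets d

sum-σ-complete : ∀ {d} {vs : List (V (suc d))} → Unique vs → (∀ v → v ∈ vs) →
                 sum (map σ vs) ≡ 0ℤ
sum-σ-complete {d} uvs complete =
  trans (sum-map-↭ σ (unique-sameElements⇒↭ uvs (subsets-unique (suc d))
                       (mk⇔ (λ _ → ∈-subsets _) (λ _ → complete _))))
        (sum-σ-subsets d)

_≟ᵥ_ : ∀ {d} → DecidableEquality (V d)
_≟ᵥ_ = Vec.≡-dec Bool._≟_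

-- In dimension d + 1, since the signs of Q_0 do not cancel.
module CycleThroughMatching
  {d} {x y : V (suc d)} (x≢y : x ≢ y) {M : EdgeRel (suc d)} (PM : IsPerfectMatchingAvoiding x y M)
  {a b c t} (uvs : Unique (a ∷ b ∷ c ∷ t))
  (M⊆C   : ∀ u w → M u w → CStep (a ∷ b ∷ c ∷ t) u w ⊎ CStep (a ∷ b ∷ c ∷ t) w u)
  (C∖M⊆Q : ∀ u w → CStep (a ∷ b ∷ c ∷ t) u w ⊎ CStep (a ∷ b ∷ c ∷ t) w u → ¬ M u w → QAdj u w)
  (x∉ : x ∉ a ∷ b ∷ c ∷ t)
  where

  vs : List (V (suc d))
  vs = a ∷ b ∷ c ∷ t

  M-sym : ∀ u w → M u w → M w u
  M-sym = proj₁ PM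

  M-avoids : ∀ u w → M u w → (u ≢ x) × (u ≢ y)
  M-avoids = proj₁ (proj₂ (proj₂ PM))

  M-perfect : ∀ u → u ≢ x → u ≢ y → Σ (V (suc d)) λ w → M u w × (∀ w′ → M u w′ → w′ ≡ w)
  M-perfect = proj₂ (proj₂ (proj₂ PM))

  M-unique : ∀ {u w w′} → M u w → M u w′ → w ≡ w′
  M-unique {u} Muw Muw′ with M-perfect u (proj₁ (M-avoids u _ Muw)) (proj₂ (M-avoids u _ Muw))
  ... | _ , _ , only = trans (only _ Muw) (sym (only _ Muw′))

  M? : ∀ u w → Dec (M u w)
  M? u w with u ≟ᵥ x | u ≟ᵥ y
  ... | yes u≡x | _       = no λ Muw → proj₁ (M-avoids u w Muw) u≡x
  ... | no _    | yes u≡y = no λ Muw → proj₂ (M-avoids u w Muw) u≡y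
  ... | no u≢x  | no u≢y  with M-perfect u u≢x u≢y
  ...   | w′ , Muw′ , _ with w ≟ᵥ w′
  ...     | yes refl = yes Muw′
  ...     | no w≢w′  = no λ Muw → w≢w′ (M-unique Muw Muw′)

  m : V (suc d) → V (suc d) → ℤ
  m u w = 𝟙 (M? u w)

  ι : V (suc d) → ℤ
  ι v = 𝟙 (v ≟ᵥ y)

  P : List (V (suc d) × V (suc d))
  P = cyclicPairs vs

  T : List (V (suc d) × V (suc d) × V (suc d))
  T = cyclicTriples vs

  cycleEdge⇒∈-P : ∀ {u w} → CStep vs u w ⊎ CStep vs w u → (u , w) ∈ P ⊎ (w , u) ∈ P
  cycleEdge⇒∈-P (inj₁ s) = inj₁ (Step⇒∈-pairs s)
  cycleEdge⇒∈-P (inj₂ s) = inj₂ (Step⇒∈-pairs s)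

  ∈-P⇒∈-vs : ∀ {u w} → (u , w) ∈ P → u ∈ vs × w ∈ vs
  ∈-P⇒∈-vs {u} uw∈ = subst (u ∈_) (map-proj₁-cyclicPairs vs) (∈-map⁺ proj₁ uw∈) ,
                     ∈-resp-↭ (map-proj₂-cyclicPairs vs) (∈-map⁺ proj₂ uw∈)

  on-cycle : ∀ {u} → u ≢ x → u ≢ y → u ∈ vs
  on-cycle {u} u≢x u≢y with M-perfect u u≢x u≢y
  ... | w , Muw , _ with cycleEdge⇒∈-P (M⊆C u w Muw)
  ...   | inj₁ uw∈ = proj₁ (∈-P⇒∈-vs uw∈)
  ...   | inj₂ wu∈ = proj₂ (∈-P⇒∈-vs wu∈)

  edge-weight : ∀ {u w} → (u , w) ∈ P → σ u + σ w ≡ m u w * (σ u + σ w)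
  edge-weight {u} {w} uw∈ with M? u w
  ... | yes _   = sym (ℤ.*-identityˡ (σ u + σ w))
  ... | no ¬Muw =
    σ-adjacent {u = u} {w} (C∖M⊆Q u w (inj₁ (∈-pairs⇒Step (vs ∷ʳ a) uw∈)) ¬Muw)

  weight-at-y : ∀ p n → m p y + m y n ≡ 0ℤ
  weight-at-y p n = cong₂ _+_ (𝟙-no (M? p y) λ Mpy → proj₂ (M-avoids y p (M-sym p y Mpy)) refl)
                              (𝟙-no (M? y n) λ Myn → proj₂ (M-avoids y n Myn) refl)

  -- The matching edge of v is one of its two cycle edges, and not both since p ≢ n.
  matched-once : ∀ {p v n w} → p ≢ n → (p , v) ∈ P → (v , n) ∈ P → M v w → m p v + m v n ≡ 1ℤ
  matched-once {p} {v} {n} {w} p≢n pv∈ vn∈ Mvw with cycleEdge⇒∈-P (M⊆C v w Mvw)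
  ... | inj₁ vw∈ = cong₂ _+_ (𝟙-no (M? p v) λ Mpv → p≢n (trans (M-unique (M-sym p v Mpv) Mvw) w≡n))
                             (𝟙-yes (M? v n) (subst (M v) w≡n Mvw))
    where
    w≡n : w ≡ n
    w≡n = cyclicPairs-successor-unique uvs vw∈ vn∈
  ... | inj₂ wv∈ = cong₂ _+_ (𝟙-yes (M? p v) (M-sym v p (subst (M v) w≡p Mvw)))
                             (𝟙-no (M? v n) λ Mvn → p≢n (trans (sym w≡p) (M-unique Mvw Mvn)))
    where
    w≡p : w ≡ p
    w≡p = cyclicPairs-predecessor-unique uvs wv∈ pv∈

  weight-off-y : ∀ {p v n} → (p , v , n) ∈ T → v ≢ y → m p v + m v n ≡ 1ℤ
  weight-off-y {p} {v} {n} pvn∈ v≢y with ∈-cyclicTriples⇒∈-cyclicPairs {xs = vs} pvn∈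
  ... | pv∈ , vn∈ =
    matched-once (cyclicTriples-ends-distinct uvs pvn∈) pv∈ vn∈
                 (proj₁ (proj₂ (M-perfect v v≢x v≢y)))
    where
    v≢x : v ≢ x
    v≢x refl = x∉ (proj₂ (∈-P⇒∈-vs pv∈))

  vertex-weight : ∀ {p v n} → (p , v , n) ∈ T → (m p v + m v n) + ι v ≡ 1ℤ
  vertex-weight {p} {v} {n} pvn∈ = by-cases (v ≟ᵥ y)
    where
    by-cases : Dec (v ≡ y) → (m p v + m v n) + ι v ≡ 1ℤ
    by-cases (yes v≡y) = subst (λ v → (m p v + m v n) + ι v ≡ 1ℤ) (sym v≡y)
                               (cong₂ _+_ (weight-at-y p n) (𝟙-yes (y ≟ᵥ y) refl))
    by-cases (no v≢y)  = cong₂ _+_ (weight-off-y pvn∈ v≢y) (𝟙-no (v ≟ᵥ y) v≢y)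

  S : ℤ
  S = sum (map σ vs)

  cycle-sum : S + sum (map (λ v → ι v * σ v) vs) ≡ 0ℤ
  cycle-sum = trans (regroup S Y) (trans (cong (λ z → (z + Y) + - S) twice)
                                         (trans (cong (_+ - S) once) (ℤ.+-inverseʳ S)))
    where
    open ≡-Reasoning
    Y A : ℤ
    Y = sum (map (λ v → ι v * σ v) vs)
    A = sum (map (λ (p , v , n) → (m p v + m v n) * σ v) T)
    regroup : ∀ S Y → S + Y ≡ ((S + S) + Y) + - S
    regroup = solve-∀
    twice : S + S ≡ A
    twice = begin
      S + S                                          ≡⟨ sum-cyclicPairs-endpoints σ vs ⟨
      sum (map (λ (u , w) → σ u + σ w) P)            ≡⟨ sum-map-cong P edge-weight ⟩
      sum (map (λ (u , w) → m u w * (σ u + σ w)) P)  ≡⟨ sum-cyclicPairs-by-triples m σ vs ⟩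
      A                                              ∎
    vertex-term : ∀ {e} → e ∈ T → let (p , v , n) = e in (m p v + m v n) * σ v + ι v * σ v ≡ σ v
    vertex-term {p , v , n} pvn∈ = begin
      (m p v + m v n) * σ v + ι v * σ v  ≡⟨ ℤ.*-distribʳ-+ (σ v) (m p v + m v n) (ι v) ⟨
      ((m p v + m v n) + ι v) * σ v      ≡⟨ cong (_* σ v) (vertex-weight pvn∈) ⟩
      1ℤ * σ v                           ≡⟨ ℤ.*-identityˡ (σ v) ⟩
      σ v                                ∎
    once : A + Y ≡ S
    once = begin
      A + Y
        ≡⟨ cong (A +_) (sum-cyclicTriples-middle (λ v → ι v * σ v) vs) ⟨
      A + sum (map (λ (_ , v , _) → ι v * σ v) T)
        ≡⟨ sum-map-+ (λ (p , v , n) → (m p v + m v n) * σ v) (λ (_ , v , _) → ι v * σ v) T ⟨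
      sum (map (λ (p , v , n) → (m p v + m v n) * σ v + ι v * σ v) T)
        ≡⟨ sum-map-cong T vertex-term ⟩
      sum (map (λ (_ , v , _) → σ v) T)
        ≡⟨ sum-cyclicTriples-middle σ vs ⟩
      S
        ∎

  every-vertex : ∀ v → v ≡ x ⊎ v ≡ y ⊎ v ∈ vs
  every-vertex v with v ≟ᵥ x | v ≟ᵥ y
  ... | yes v≡x | _       = inj₁ v≡x
  ... | no _    | yes v≡y = inj₂ (inj₁ v≡y)
  ... | no v≢x  | no v≢y  = inj₂ (inj₂ (on-cycle v≢x v≢y))

  avoids⇒opposite-parity : y ∉ vs → OppositeParity x y
  avoids⇒opposite-parity y∉ same-parity = sgn+sgn≢0 ∣ y ∣ (begin
    σ y + σ y         ≡⟨ cong (_+ σ y) σx≡σy ⟨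
    σ x + σ y         ≡⟨ cong (σ x +_) (ℤ.+-identityʳ (σ y)) ⟨
    σ x + (σ y + 0ℤ)  ≡⟨ cong (λ s → σ x + (σ y + s)) S≡0 ⟨
    σ x + (σ y + S)   ≡⟨ sum-σ-complete ((x≢y ∷ ¬Any⇒All¬ vs x∉) ∷ ¬Any⇒All¬ vs y∉ ∷ uvs) complete ⟩
    0ℤ                ∎)
    where
    open ≡-Reasoning
    σx≡σy : σ x ≡ σ y
    σx≡σy = trans (sym (sgn-%2 ∣ x ∣)) (trans (cong sgn same-parity) (sgn-%2 ∣ y ∣))
    S≡0 : S ≡ 0ℤ
    S≡0 = trans (sym (ℤ.+-identityʳ S))
                (trans (cong (S +_) (sym (sum-map-𝟙-∉ _≟ᵥ_ σ y∉))) cycle-sum)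
    complete : ∀ v → v ∈ x ∷ y ∷ vs
    complete v with every-vertex v
    ... | inj₁ v≡x        = here v≡x
    ... | inj₂ (inj₁ v≡y) = there (here v≡y)
    ... | inj₂ (inj₂ v∈)  = there (there v∈)

  visits⇒same-parity : y ∈ vs → ∣ x ∣ % 2 ≡ ∣ y ∣ % 2
  visits⇒same-parity y∈ = sgn-injective-%2 ∣ x ∣ ∣ y ∣ (+-inverse-unique total around-cycle)
    where
    complete : ∀ v → v ∈ x ∷ vs
    complete v with every-vertex v
    ... | inj₁ v≡x         = here v≡x
    ... | inj₂ (inj₁ refl) = there y∈
    ... | inj₂ (inj₂ v∈)   = there v∈
    total : σ x + S ≡ 0ℤ
    total = sum-σ-complete (¬Any⇒All¬ vs x∉ ∷ uvs) complete
    around-cycle : S + σ y ≡ 0ℤ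
    around-cycle = trans (cong (S +_) (sym (sum-map-𝟙-∈ _≟ᵥ_ σ uvs y∈))) cycle-sum

lemma13 : (d : ℕ) (x y : V d) → x ≢ y →
          (M : EdgeRel d) → IsPerfectMatchingAvoiding x y M →
          (C : Cycle d) → Extends C M → Avoids C x →
          (Avoids C y ⇔ OppositeParity x y)
lemma13 zero [] [] x≢y _ _ _ _ _ = ⊥-elim (x≢y refl)
lemma13 (suc d) _ _ _ _ _ (cycle []               ()                _) _ _
lemma13 (suc d) _ _ _ _ _ (cycle (_ ∷ [])         (s≤s ())          _) _ _
lemma13 (suc d) _ _ _ _ _ (cycle (_ ∷ _ ∷ [])     (s≤s (s≤s ()))    _) _ _
lemma13 (suc d) x y x≢y M PM (cycle (a ∷ b ∷ c ∷ t) _ uvs) (M⊆C , C∖M⊆Q) x∉ =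
  mk⇔ avoids⇒opposite-parity (λ opposite y∈ → opposite (visits⇒same-parity y∈))
  where open CycleThroughMatching x≢y PM uvs M⊆C C∖M⊆Q x∉
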